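{- Let $E$ be an elliptic curve over a number field $K$ given by $y^2=x^3+ax+b$, with origin $\mathcal{O}$. Let $T_1,T_2,T_3\in E[3]\setminus\{\mathcal{O}\}$ with $T_1+T_2+T_3=\mathcal{O}$. Then $$\lambda(T_1,T_2)=\tfrac13\sum_{i=1}^3\lambda(T_i,T_i).$$
   Context: For points $P,Q\in E(\overline K)\setminus\{\mathcal O\}$ with $P+Q\neq\mathcal O$, $\lambda(P,Q)$ denotes the slope of the line through $P$ and $Q$, or of the tangent line to $E$ at $P$ if $P=Q$. -}

module Defs where

open import Level using (Level; _⊔_) renaming (suc to lsuc)
open import Algebra.Bundles using (CommutativeRing)
open import Relation.Nullary using (¬_; yes; no)
open import Relation.Binary.Definitions using (Decidable)
open import Relation.Binary.PropositionalEquality using (_≢_)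
open import Data.Nat as ℕ using (ℕ)
open import Data.Integer as ℤ using (ℤ; +_; -[1+_])
open import Data.List using (List; []; _∷_)
open import Data.List.Relation.Unary.Any using (Any)
open import Data.Product using (∃; _×_)
open import Data.Unit.Polymorphic using (⊤)
open import Data.Empty.Polymorphic using (⊥)

-- A field with decidable equality and a total inverse (convention 0⁻¹ = 0;
-- only x ⁻¹ for x ≉ 0 is constrained beyond that).
record Field (c ℓ : Level) : Set (lsuc (c ⊔ ℓ)) where
  field
    commutativeRing : CommutativeRing c ℓ
  open CommutativeRing commutativeRing public
  field
    _⁻¹        : Carrier → Carrier
    1≉0        : ¬ (1# ≈ 0#)
    ⁻¹-inverse : ∀ x → ¬ (x ≈ 0#) → x * (x ⁻¹) ≈ 1#
    ⁻¹-zero    : (0# ⁻¹) ≈ 0#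
    _≟_        : Decidable _≈_

module FieldTheory {c ℓ : Level} (F : Field c ℓ) where
  open Field F

  fromℕ : ℕ → Carrier
  fromℕ ℕ.zero    = 0#
  fromℕ (ℕ.suc n) = 1# + fromℕ n

  fromℤ : ℤ → Carrier
  fromℤ (+ n)      = fromℕ n
  fromℤ -[1+ n ]   = - fromℕ (ℕ.suc n)

  -- polynomial evaluation, coefficients listed from the constant term up
  eval : List Carrier → Carrier → Carrier
  eval []       x = 0#
  eval (k ∷ ks) x = k + x * eval ks x

  evalℤ : List ℤ → Carrier → Carrier
  evalℤ []       x = 0#
  evalℤ (k ∷ ks) x = fromℤ k + x * evalℤ ks x

  CharZero : Set ℓ
  CharZero = ∀ n → ¬ (fromℕ (ℕ.suc n) ≈ 0#)

  -- every monic polynomial k₀ + k₁X + … + k_{n-1}X^{n-1} + X^n with n ≥ 1 has a root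
  AlgClosed : Set (c ⊔ ℓ)
  AlgClosed = ∀ (k : Carrier) (ks : List Carrier) →
    ∃ λ x → eval (k ∷ ks) x + (x * monicTop ks x) ≈ 0#
    where
      monicTop : List Carrier → Carrier → Carrier
      monicTop []       x = 1#
      monicTop (_ ∷ ks) x = x * monicTop ks x

  IsAlgebraic : Carrier → Set ℓ
  IsAlgebraic x = ∃ λ (ks : List ℤ) → Any (λ k → k ≢ ℤ.0ℤ) ks × (evalℤ ks x ≈ 0#)

  IsAlgClosureOfℚ : Set (c ⊔ ℓ)
  IsAlgClosureOfℚ = CharZero × AlgClosed × (∀ x → IsAlgebraic x)

module Weierstrass {c ℓ : Level} (F : Field c ℓ) (a b : Field.Carrier F) where
  open Field F

  two three four twentyseven : Carrier
  two   = 1# + 1#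
  three = 1# + two
  four  = two + two
  twentyseven = three * three * three

  Nonsingular : Set ℓ
  Nonsingular = ¬ (four * (a * a * a) + twentyseven * (b * b) ≈ 0#)

  data Point : Set c where
    𝒪   : Point
    aff : Carrier → Carrier → Point

  OnCurve : Point → Set ℓ
  OnCurve 𝒪         = ⊤
  OnCurve (aff x y) = y * y ≈ x * x * x + a * x + b

  _≅_ : Point → Point → Set ℓ
  𝒪       ≅ 𝒪         = ⊤
  𝒪       ≅ aff _ _   = ⊥
  aff _ _ ≅ 𝒪         = ⊥
  aff x y ≅ aff x' y' = (x ≈ x') × (y ≈ y')

  -- slope λ(P,Q): chord slope if x_P ≠ x_Q, otherwise tangent slope at P.
  -- (Value on 𝒪 is an irrelevant convention; only used where defined.)
  slope : Point → Point → Carrier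
  slope 𝒪 _ = 0#
  slope (aff _ _) 𝒪 = 0#
  slope (aff x₁ y₁) (aff x₂ y₂) with x₁ ≟ x₂
  ... | no  _ = (y₂ - y₁) * ((x₂ - x₁) ⁻¹)
  ... | yes _ = (three * (x₁ * x₁) + a) * ((two * y₁) ⁻¹)

  _⊕_ : Point → Point → Point
  𝒪 ⊕ Q = Q
  aff x y ⊕ 𝒪 = aff x y
  aff x₁ y₁ ⊕ aff x₂ y₂ with x₁ ≟ x₂ | y₁ ≟ (- y₂)
  ... | yes _ | yes _ = 𝒪
  ... | _     | _     =
    let l  = slope (aff x₁ y₁) (aff x₂ y₂)
        x₃ = l * l - x₁ - x₂
    in aff x₃ (l * (x₁ - x₃) - y₁)

  In3Torsion : Point → Set ℓ
  In3Torsion T = ((T ⊕ T) ⊕ T) ≅ 𝒪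

module Submission where

-- A 3-torsion point is a flex: with t its tangent slope, 2T = −T gives t² = 3x, and
-- T ≠ −T gives y ≠ 0.  If x₁ ≠ x₂, the three points lie on the chord y = L x + m, so
-- x₁, x₂, x₃ are the roots of x³ + a x + b − (L x + m)² (ChordAlgebra.Roots).  Comparing
-- derivatives, 2yᵢ(tᵢ − L) = (xᵢ − xⱼ)(xᵢ − xₖ); with tᵢ² = 3xᵢ this gives a relation
-- linear in tᵢ, and Lagrange interpolation at the three roots turns the three relations into
-- δ·(t₁ + t₂ + t₃ − 3L) = 0 with δ the Vandermonde product, which is nonzero since a flex
-- that is a double root of the chord cubic is a triple root, forcing x₁ = x₂.  If x₁ = x₂ then T₂ = T₁ (T₂ = −T₁ would make the
-- sum T₃ ≠ 𝒪) and T₃ = T₁, so all slopes agree.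

open import Defs
open import Level using (Level)
open import Relation.Nullary using (¬_; yes; no; Dec)

open import Algebra.Bundles using (CommutativeRing)
open import Data.Nat as ℕ using (ℕ; zero; suc)
import Data.Nat.Properties as ℕ
open import Data.Integer as ℤ using (ℤ; +_; -[1+_]; _⊖_)
import Data.Integer.Properties as ℤ
open import Data.Maybe using (Maybe; just; nothing)
open import Data.Product using (_×_; _,_; proj₁; proj₂)
open import Data.Sum using (_⊎_; inj₁; inj₂)
open import Data.Empty using (⊥-elim)
import Data.Empty.Polymorphic as ⊥ℓ
open import Data.Unit.Polymorphic using (tt)
open import Relation.Binary.PropositionalEquality as ≡ using (_≡_)

-- The image of n is 1# + (1# + …) with no trailing
-- 0#, so that 2 and 3 are literally 1# + 1# and 1# + (1# + 1#).
module IntegerRingSolver {c ℓ : Level} (R : CommutativeRing c ℓ) where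
  open CommutativeRing R
  open import Algebra.Properties.Ring ring
    using (-0#≈0#; -‿involutive; -‿+-comm; -‿distribˡ-*; -‿distribʳ-*; x∙y⁻¹≈ε⇒x≈y)
  open import Relation.Binary.Reasoning.Setoid setoid

  embedℕ : ℕ → Carrier
  embedℕ 0             = 0#
  embedℕ 1             = 1#
  embedℕ (suc (suc n)) = 1# + embedℕ (suc n)

  embedℕ-suc : ∀ n → embedℕ (suc n) ≈ 1# + embedℕ n
  embedℕ-suc zero    = sym (+-identityʳ 1#)
  embedℕ-suc (suc n) = refl

  embedℕ-+ : ∀ m n → embedℕ (m ℕ.+ n) ≈ embedℕ m + embedℕ n
  embedℕ-+ zero    n = sym (+-identityˡ _)
  embedℕ-+ (suc m) n = begin
    embedℕ (suc (m ℕ.+ n))        ≈⟨ embedℕ-suc (m ℕ.+ n) ⟩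
    1# + embedℕ (m ℕ.+ n)         ≈⟨ +-congˡ (embedℕ-+ m n) ⟩
    1# + (embedℕ m + embedℕ n)    ≈⟨ +-assoc 1# _ _ ⟨
    (1# + embedℕ m) + embedℕ n    ≈⟨ +-congʳ (embedℕ-suc m) ⟨
    embedℕ (suc m) + embedℕ n     ∎

  embedℕ-* : ∀ m n → embedℕ (m ℕ.* n) ≈ embedℕ m * embedℕ n
  embedℕ-* zero    n = sym (zeroˡ _)
  embedℕ-* (suc m) n = begin
    embedℕ (n ℕ.+ m ℕ.* n)             ≈⟨ embedℕ-+ n (m ℕ.* n) ⟩
    embedℕ n + embedℕ (m ℕ.* n)        ≈⟨ +-cong (sym (*-identityˡ _)) (embedℕ-* m n) ⟩
    1# * embedℕ n + embedℕ m * embedℕ n ≈⟨ distribʳ _ _ _ ⟨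
    (1# + embedℕ m) * embedℕ n          ≈⟨ *-congʳ (embedℕ-suc m) ⟨
    embedℕ (suc m) * embedℕ n          ∎

  two three : Carrier
  two   = embedℕ 2
  three = embedℕ 3

  embedℤ : ℤ → Carrier
  embedℤ (+ n)    = embedℕ n
  embedℤ -[1+ n ] = - embedℕ (suc n)

  embedℤ-neg : ∀ i → embedℤ (ℤ.- i) ≈ - embedℤ i
  embedℤ-neg (+ zero)  = sym -0#≈0#
  embedℤ-neg (+ suc n) = refl
  embedℤ-neg -[1+ n ]  = sym (-‿involutive _)

  embedℤ-⊖ : ∀ m n → embedℤ (m ⊖ n) ≈ embedℕ m - embedℕ n
  embedℤ-⊖ m       zero    = sym (trans (+-congˡ -0#≈0#) (+-identityʳ _))
  embedℤ-⊖ zero    (suc n) = sym (+-identityˡ _)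
  embedℤ-⊖ (suc m) (suc n) = begin
    embedℤ (suc m ⊖ suc n)                      ≡⟨ ≡.cong embedℤ (ℤ.[1+m]⊖[1+n]≡m⊖n m n) ⟩
    embedℤ (m ⊖ n)                              ≈⟨ embedℤ-⊖ m n ⟩
    embedℕ m - embedℕ n                         ≈⟨ shift ⟩
    (1# + embedℕ m) - (1# + embedℕ n)           ≈⟨ +-cong (embedℕ-suc m) (-‿cong (embedℕ-suc n)) ⟨
    embedℕ (suc m) - embedℕ (suc n)             ∎
    where
    shift : ∀ {u v} → u - v ≈ (1# + u) - (1# + v)
    shift {u} {v} = begin
      u - v                   ≈⟨ +-identityˡ _ ⟨
      0# + (u - v)            ≈⟨ +-congʳ (-‿inverseʳ 1#) ⟨
      (1# - 1#) + (u - v)     ≈⟨ +-assoc 1# _ _ ⟩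
      1# + (- 1# + (u - v))   ≈⟨ +-congˡ (+-assoc (- 1#) u (- v)) ⟨
      1# + ((- 1# + u) - v)   ≈⟨ +-congˡ (+-congʳ (+-comm (- 1#) u)) ⟩
      1# + ((u - 1#) - v)     ≈⟨ +-congˡ (+-assoc u (- 1#) (- v)) ⟩
      1# + (u + (- 1# - v))   ≈⟨ +-assoc 1# u _ ⟨
      (1# + u) + (- 1# - v)   ≈⟨ +-congˡ (-‿+-comm 1# v) ⟩
      (1# + u) - (1# + v)     ∎

  embedℤ-+ : ∀ i j → embedℤ (i ℤ.+ j) ≈ embedℤ i + embedℤ j
  embedℤ-+ (+ m)    (+ n)    = embedℕ-+ m n
  embedℤ-+ (+ m)    -[1+ n ] = embedℤ-⊖ m (suc n)
  embedℤ-+ -[1+ m ] (+ n)    = trans (embedℤ-⊖ n (suc m)) (+-comm _ _)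
  embedℤ-+ -[1+ m ] -[1+ n ] = begin
    - embedℕ (suc (suc (m ℕ.+ n)))               ≡⟨ ≡.cong (λ k → - embedℕ (suc k)) (ℕ.+-suc m n) ⟨
    - embedℕ (suc m ℕ.+ suc n)                   ≈⟨ -‿cong (embedℕ-+ (suc m) (suc n)) ⟩
    - (embedℕ (suc m) + embedℕ (suc n))          ≈⟨ -‿+-comm _ _ ⟨
    - embedℕ (suc m) - embedℕ (suc n)            ∎

  embedℤ-*-pos : ∀ m j → embedℤ (+ m ℤ.* j) ≈ embedℕ m * embedℤ j
  embedℤ-*-pos m (+ n)    = begin
    embedℤ (+ m ℤ.* + n)    ≡⟨ ≡.cong embedℤ (ℤ.pos-* m n) ⟨
    embedℕ (m ℕ.* n)        ≈⟨ embedℕ-* m n ⟩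
    embedℕ m * embedℕ n     ∎
  embedℤ-*-pos m -[1+ n ] = begin
    embedℤ (+ m ℤ.* ℤ.- + suc n)          ≡⟨ ≡.cong embedℤ (ℤ.neg-distribʳ-* (+ m) (+ suc n)) ⟨
    embedℤ (ℤ.- (+ m ℤ.* + suc n))        ≈⟨ embedℤ-neg (+ m ℤ.* + suc n) ⟩
    - embedℤ (+ m ℤ.* + suc n)            ≈⟨ -‿cong (embedℤ-*-pos m (+ suc n)) ⟩
    - (embedℕ m * embedℕ (suc n))         ≈⟨ -‿distribʳ-* _ _ ⟩
    embedℕ m * - embedℕ (suc n)           ∎

  embedℤ-* : ∀ i j → embedℤ (i ℤ.* j) ≈ embedℤ i * embedℤ j
  embedℤ-* (+ m)    j = embedℤ-*-pos m j
  embedℤ-* -[1+ m ] j = begin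
    embedℤ (ℤ.- (+ suc m) ℤ.* j)          ≡⟨ ≡.cong embedℤ (ℤ.neg-distribˡ-* (+ suc m) j) ⟨
    embedℤ (ℤ.- (+ suc m ℤ.* j))          ≈⟨ embedℤ-neg (+ suc m ℤ.* j) ⟩
    - embedℤ (+ suc m ℤ.* j)              ≈⟨ -‿cong (embedℤ-*-pos (suc m) j) ⟩
    - (embedℕ (suc m) * embedℤ j)         ≈⟨ -‿distribˡ-* _ _ ⟩
    - embedℕ (suc m) * embedℤ j           ∎

  open import Algebra.Solver.Ring.AlmostCommutativeRing
    using (fromCommutativeRing; _-Raw-AlmostCommutative⟶_)

  embedℤ-homomorphism : ℤ.+-*-rawRing -Raw-AlmostCommutative⟶ fromCommutativeRing R
  embedℤ-homomorphism = record
    { ⟦_⟧ = embedℤ ; +-homo = embedℤ-+ ; *-homo = embedℤ-* ; -‿homo = embedℤ-neg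
    ; 0-homo = refl ; 1-homo = refl }

  -- equal integer coefficients have equal images (all the solver needs)
  coefficient-equality : ∀ i j → Maybe (embedℤ i ≈ embedℤ j)
  coefficient-equality i j with i ℤ.≟ j
  ... | yes ≡.refl = just refl
  ... | no _       = nothing

  open import Algebra.Solver.Ring ℤ.+-*-rawRing (fromCommutativeRing R)
    embedℤ-homomorphism coefficient-equality public

  -- Certificates: to prove p ≈ q from hypotheses pᵢ ≈ qᵢ, exhibit p − q as a
  -- combination Σ cᵢ (pᵢ − qᵢ) (checked by 'solve') and note that each summand vanishes.
  residual : ∀ {p q} → p ≈ q → p - q ≈ 0#
  residual {p} {q} p≈q = trans (+-congʳ p≈q) (-‿inverseʳ q)

  fromResidual : ∀ {p q} → p - q ≈ 0# → p ≈ q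
  fromResidual {p} {q} = x∙y⁻¹≈ε⇒x≈y p q

  infixl 6 _+₀_
  infixl 7 _·₀_

  _·₀_ : ∀ k {r} → r ≈ 0# → k * r ≈ 0#
  k ·₀ r≈0 = trans (*-congˡ r≈0) (zeroʳ k)

  _+₀_ : ∀ {r s} → r ≈ 0# → s ≈ 0# → r + s ≈ 0#
  r≈0 +₀ s≈0 = trans (+-cong r≈0 s≈0) (+-identityʳ 0#)

module ChordAlgebra {c ℓ : Level} (R : CommutativeRing c ℓ) (a b L m : CommutativeRing.Carrier R) where
  open CommutativeRing R
  open IntegerRingSolver R
  open import Relation.Binary.Reasoning.Setoid setoid

  OnLine : Carrier → Carrier → Set ℓ
  OnLine u y = y ≈ L * u + m

  -- u, v, w satisfy the first two Vieta relations of the roots of the cubic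
  -- x³ + a x + b − (L x + m)², whose x²-coefficient is −L² and x-coefficient a − 2Lm.
  Roots : Carrier → Carrier → Carrier → Set ℓ
  Roots u v w = (u + v + w ≈ L * L) × (u * v + v * w + w * u + two * (L * m) ≈ a)

  Roots-rotate : ∀ {u v w} → Roots u v w → Roots v w u
  Roots-rotate {u} {v} {w} (σ₁ , σ₂) =
      trans (solve 3 (λ u v w → v :+ w :+ u := u :+ v :+ w) refl u v w) σ₁
    , trans (+-congʳ (solve 3 (λ u v w → v :* w :+ w :* u :+ u :* v := u :* v :+ v :* w :+ w :* u) refl u v w)) σ₂

  OnCubic : Carrier → Carrier → Set ℓ
  OnCubic u y = y * y ≈ u * u * u + a * u + b

  -- x³ + a x + b − (L x + m)² − (x − x₁)(x − x₂)(x − x₃) is linear once x₁ + x₂ + x₃ = L²;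
  -- it vanishes at x₁ and x₂, so (x₁ − x₂) times its slope is 0.
  chordVieta : ∀ {x₁ x₂ x₃ y₁ y₂} → OnLine x₁ y₁ → OnLine x₂ y₂ → OnCubic x₁ y₁ → OnCubic x₂ y₂ →
    x₁ + x₂ + x₃ ≈ L * L → (x₁ - x₂) * (x₁ * x₂ + x₂ * x₃ + x₃ * x₁ + two * (L * m) - a) ≈ 0#
  chordVieta {x₁} {x₂} {x₃} {y₁} {y₂} ℓ₁ ℓ₂ c₁ c₂ σ = trans
    (solve 9 (λ x₁ x₂ x₃ y₁ y₂ a b L m →
       (x₁ :- x₂) :* (x₁ :* x₂ :+ x₂ :* x₃ :+ x₃ :* x₁ :+ con (+ 2) :* (L :* m) :- a)
         := (y₁ :* y₁ :- (x₁ :* x₁ :* x₁ :+ a :* x₁ :+ b))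
         :+ con -[1+ 0 ] :* (y₂ :* y₂ :- (x₂ :* x₂ :* x₂ :+ a :* x₂ :+ b))
         :+ con -[1+ 0 ] :* (y₁ :+ L :* x₁ :+ m) :* (y₁ :- (L :* x₁ :+ m))
         :+ (y₂ :+ L :* x₂ :+ m) :* (y₂ :- (L :* x₂ :+ m))
         :+ (x₁ :+ x₂) :* (x₁ :- x₂) :* (x₁ :+ x₂ :+ x₃ :- L :* L))
       refl x₁ x₂ x₃ y₁ y₂ a b L m)
    (   residual c₁ +₀ - 1# ·₀ residual c₂
     +₀ - 1# * (y₁ + L * x₁ + m) ·₀ residual ℓ₁ +₀ (y₂ + L * x₂ + m) ·₀ residual ℓ₂
     +₀ (x₁ + x₂) * (x₁ - x₂) ·₀ residual σ)

  -- At a root u lying on the curve, the tangent slope exceeds the chord slope by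
  -- f'(u)/2y, where f'(u) = (u − v)(u − w) is the derivative of the cubic at u.
  tangentExcess : ∀ {u v w y t} → Roots u v w → OnLine u y →
    t * (two * y) ≈ three * (u * u) + a → two * y * (t - L) ≈ (u - v) * (u - w)
  tangentExcess {u} {v} {w} {y} {t} (σ₁ , σ₂) onLine tangent = begin
    two * y * (t - L)                               ≈⟨ solve 3 (λ y t L → con (+ 2) :* y :* (t :- L)
                                                          := t :* (con (+ 2) :* y) :- con (+ 2) :* L :* y) refl y t L ⟩
    t * (two * y) - two * L * y                     ≈⟨ +-cong tangent (-‿cong (*-congˡ onLine)) ⟩
    three * (u * u) + a - two * L * (L * u + m)     ≈⟨ fromResidual (trans
         (solve 6 (λ u v w a L m →
            con (+ 3) :* (u :* u) :+ a :- con (+ 2) :* L :* (L :* u :+ m) :- (u :- v) :* (u :- w)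
              := con (+ 2) :* u :* (u :+ v :+ w :- L :* L) :+ con -[1+ 0 ] :* (u :* v :+ v :* w :+ w :* u :+ con (+ 2) :* (L :* m) :- a))
            refl u v w a L m)
         (two * u ·₀ residual σ₁ +₀ - 1# ·₀ residual σ₂)) ⟩
    (u - v) * (u - w)                               ∎

  flexExcess : ∀ {u y t D} → t * t ≈ three * u → two * y * (t - L) ≈ D →
    D * (t + L) ≈ two * y * (three * u - L * L)
  flexExcess {u} {y} {t} {D} flex excess = begin
    D * (t + L)                       ≈⟨ *-congʳ excess ⟨
    two * y * (t - L) * (t + L)       ≈⟨ solve 3 (λ y t L → con (+ 2) :* y :* (t :- L) :* (t :+ L)
                                            := con (+ 2) :* y :* (t :* t :- L :* L)) refl y t L ⟩
    two * y * (t * t - L * L)         ≈⟨ *-congˡ (+-congʳ flex) ⟩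
    two * y * (three * u - L * L)     ∎

  flexOnChord : ∀ {u v w t} → Roots u v w → t ≈ L → t * t ≈ three * u → (v - u) + (w - u) ≈ 0#
  flexOnChord {u} {v} {w} {t} (σ₁ , _) t≈L flex = trans
    (solve 5 (λ u v w t L → (v :- u) :+ (w :- u)
       := (u :+ v :+ w :- L :* L) :+ (L :* L :- t :* t) :+ (t :* t :- con (+ 3) :* u)) refl u v w t L)
    (residual σ₁ +₀ residual (sym (*-cong t≈L t≈L)) +₀ residual flex)

  -- Three flexes on the chord: weighting the relations of 'flexExcess' by x_j − x_k and
  -- summing, the Lagrange interpolation identity Σ (x_j − x_k) p(x_i) = −(lead p)·δ for
  -- p(x) = 2(Lx + m)(3x − L²) leaves δ · (t₁ + t₂ + t₃ − 3L) = 0, δ the Vandermonde product.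
  flexSum : ∀ {x₁ x₂ x₃ y₁ y₂ y₃ t₁ t₂ t₃} →
    OnLine x₁ y₁ → OnLine x₂ y₂ → OnLine x₃ y₃ →
    (x₁ - x₂) * (x₁ - x₃) * (t₁ + L) ≈ two * y₁ * (three * x₁ - L * L) →
    (x₂ - x₃) * (x₂ - x₁) * (t₂ + L) ≈ two * y₂ * (three * x₂ - L * L) →
    (x₃ - x₁) * (x₃ - x₂) * (t₃ + L) ≈ two * y₃ * (three * x₃ - L * L) →
    (x₁ - x₂) * (x₂ - x₃) * (x₃ - x₁) * (t₁ + t₂ + t₃ - three * L) ≈ 0#
  flexSum {x₁} {x₂} {x₃} {y₁} {y₂} {y₃} {t₁} {t₂} {t₃} ℓ₁ ℓ₂ ℓ₃ e₁ e₂ e₃ = trans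
    (solve 11 (λ x₁ x₂ x₃ y₁ y₂ y₃ t₁ t₂ t₃ L m →
       (x₁ :- x₂) :* (x₂ :- x₃) :* (x₃ :- x₁) :* (t₁ :+ t₂ :+ t₃ :- con (+ 3) :* L)
         := (x₃ :- x₂) :* ((x₁ :- x₂) :* (x₁ :- x₃) :* (t₁ :+ L) :- con (+ 2) :* y₁ :* (con (+ 3) :* x₁ :- L :* L))
         :+ (x₁ :- x₃) :* ((x₂ :- x₃) :* (x₂ :- x₁) :* (t₂ :+ L) :- con (+ 2) :* y₂ :* (con (+ 3) :* x₂ :- L :* L))
         :+ (x₂ :- x₁) :* ((x₃ :- x₁) :* (x₃ :- x₂) :* (t₃ :+ L) :- con (+ 2) :* y₃ :* (con (+ 3) :* x₃ :- L :* L))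
         :+ con (+ 2) :* (x₃ :- x₂) :* (con (+ 3) :* x₁ :- L :* L) :* (y₁ :- (L :* x₁ :+ m))
         :+ con (+ 2) :* (x₁ :- x₃) :* (con (+ 3) :* x₂ :- L :* L) :* (y₂ :- (L :* x₂ :+ m))
         :+ con (+ 2) :* (x₂ :- x₁) :* (con (+ 3) :* x₃ :- L :* L) :* (y₃ :- (L :* x₃ :+ m)))
       refl x₁ x₂ x₃ y₁ y₂ y₃ t₁ t₂ t₃ L m)
    (  (x₃ - x₂) ·₀ residual e₁ +₀ (x₁ - x₃) ·₀ residual e₂ +₀ (x₂ - x₁) ·₀ residual e₃
    +₀ two * (x₃ - x₂) * (three * x₁ - L * L) ·₀ residual ℓ₁
    +₀ two * (x₁ - x₃) * (three * x₂ - L * L) ·₀ residual ℓ₂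
    +₀ two * (x₂ - x₁) * (three * x₃ - L * L) ·₀ residual ℓ₃)

-- For a line of slope l through (x₁, y₁) and abscissae x₁, x₂, the sum is the point
-- (l² − x₁ − x₂, l (x₁ − (l² − x₁ − x₂)) − y₁); the hypotheses below say it equals −(x₃, y₃).
module AdditionFormulas {c ℓ : Level} (R : CommutativeRing c ℓ) where
  open CommutativeRing R
  open IntegerRingSolver R

  chordLine : ∀ {L x₁ x₂ x₃ y₁ y₂ y₃} → L * (x₂ - x₁) ≈ y₂ - y₁ →
    L * L - x₁ - x₂ ≈ x₃ → L * (x₁ - (L * L - x₁ - x₂)) - y₁ ≈ - y₃ →
    let m = y₁ - L * x₁ in
    (y₁ ≈ L * x₁ + m) × (y₂ ≈ L * x₂ + m) × (y₃ ≈ L * x₃ + m) × (x₁ + x₂ + x₃ ≈ L * L)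
  chordLine {L} {x₁} {x₂} {x₃} {y₁} {y₂} {y₃} chord x≈x₃ y≈-y₃ =
      solve 3 (λ L x₁ y₁ → y₁ := L :* x₁ :+ (y₁ :- L :* x₁)) refl L x₁ y₁
    , fromResidual (trans
        (solve 5 (λ L x₁ x₂ y₁ y₂ → y₂ :- (L :* x₂ :+ (y₁ :- L :* x₁))
           := con -[1+ 0 ] :* (L :* (x₂ :- x₁) :- (y₂ :- y₁))) refl L x₁ x₂ y₁ y₂)
        (- 1# ·₀ residual chord))
    , fromResidual (trans
        (solve 6 (λ L x₁ x₂ x₃ y₁ y₃ → y₃ :- (L :* x₃ :+ (y₁ :- L :* x₁))
           := (L :* (x₁ :- (L :* L :- x₁ :- x₂)) :- y₁ :- (:- y₃)) :+ L :* (L :* L :- x₁ :- x₂ :- x₃))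
           refl L x₁ x₂ x₃ y₁ y₃)
        (residual y≈-y₃ +₀ L ·₀ residual x≈x₃))
    , fromResidual (trans
        (solve 4 (λ L x₁ x₂ x₃ → x₁ :+ x₂ :+ x₃ :- L :* L := con -[1+ 0 ] :* (L :* L :- x₁ :- x₂ :- x₃))
           refl L x₁ x₂ x₃)
        (- 1# ·₀ residual x≈x₃))

  doubledFlex : ∀ {t x₁ x₂ x₃ y₁ y₃} → t * t ≈ three * x₁ → x₁ ≈ x₂ →
    t * t - x₁ - x₂ ≈ x₃ → t * (x₁ - (t * t - x₁ - x₂)) - y₁ ≈ - y₃ → x₃ ≈ x₁ × y₃ ≈ y₁
  doubledFlex {t} {x₁} {x₂} {x₃} {y₁} {y₃} flex x₁≈x₂ x≈x₃ y≈-y₃ =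
      fromResidual (trans
        (solve 4 (λ t x₁ x₂ x₃ → x₃ :- x₁
           := con -[1+ 0 ] :* (t :* t :- x₁ :- x₂ :- x₃) :+ (t :* t :- con (+ 3) :* x₁) :+ (x₁ :- x₂))
           refl t x₁ x₂ x₃)
        (- 1# ·₀ residual x≈x₃ +₀ residual flex +₀ residual x₁≈x₂))
    , fromResidual (trans
        (solve 5 (λ t x₁ x₂ y₁ y₃ → y₃ :- y₁
           := (t :* (x₁ :- (t :* t :- x₁ :- x₂)) :- y₁ :- (:- y₃)) :+ t :* (t :* t :- con (+ 3) :* x₁) :+ t :* (x₁ :- x₂))
           refl t x₁ x₂ y₁ y₃)
        (residual y≈-y₃ +₀ t ·₀ residual flex +₀ t ·₀ residual x₁≈x₂))

module FieldFacts {c ℓ : Level} (F : Field c ℓ) where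
  open Field F
  open FieldTheory F using (CharZero)
  open IntegerRingSolver commutativeRing using (solve; _:=_; _:*_; _:+_; _:-_; residual; fromResidual)
  open import Algebra.Properties.Ring ring using (+-inverseˡ-unique)
  open import Relation.Binary.Reasoning.Setoid setoid

  ⁻¹-inverseˡ : ∀ x → ¬ x ≈ 0# → x ⁻¹ * x ≈ 1#
  ⁻¹-inverseˡ x x≉0 = trans (*-comm _ _) (⁻¹-inverse x x≉0)

  solveLinear : ∀ {k x s} → ¬ k ≈ 0# → k * x ≈ s → x ≈ k ⁻¹ * s
  solveLinear {k} {x} {s} k≉0 kx≈s = begin
    x               ≈⟨ *-identityˡ x ⟨
    1# * x          ≈⟨ *-congʳ (⁻¹-inverseˡ k k≉0) ⟨
    k ⁻¹ * k * x    ≈⟨ *-assoc _ _ _ ⟩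
    k ⁻¹ * (k * x)  ≈⟨ *-congˡ kx≈s ⟩
    k ⁻¹ * s        ∎

  cancelˡ : ∀ {k r} → ¬ k ≈ 0# → k * r ≈ 0# → r ≈ 0#
  cancelˡ {k} k≉0 kr≈0 = trans (solveLinear k≉0 kr≈0) (zeroʳ (k ⁻¹))

  integral : ∀ {x y} → x * y ≈ 0# → x ≈ 0# ⊎ y ≈ 0#
  integral {x} xy≈0 with x ≟ 0#
  ... | yes x≈0 = inj₁ x≈0
  ... | no  x≉0 = inj₂ (cancelˡ x≉0 xy≈0)

  nonzero-* : ∀ {x y} → ¬ x ≈ 0# → ¬ y ≈ 0# → ¬ x * y ≈ 0#
  nonzero-* x≉0 y≉0 xy≈0 with integral xy≈0
  ... | inj₁ x≈0 = x≉0 x≈0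
  ... | inj₂ y≈0 = y≉0 y≈0

  ⁻¹-cong : ∀ {x y} → x ≈ y → ¬ x ≈ 0# → x ⁻¹ ≈ y ⁻¹
  ⁻¹-cong {x} {y} x≈y x≉0 = begin
    x ⁻¹                   ≈⟨ *-identityʳ _ ⟨
    x ⁻¹ * 1#              ≈⟨ *-congˡ (⁻¹-inverse y (λ y≈0 → x≉0 (trans x≈y y≈0))) ⟨
    x ⁻¹ * (y * y ⁻¹)      ≈⟨ *-assoc _ _ _ ⟨
    x ⁻¹ * y * y ⁻¹        ≈⟨ *-congʳ (*-congˡ (sym x≈y)) ⟩
    x ⁻¹ * x * y ⁻¹        ≈⟨ *-congʳ (⁻¹-inverseˡ x x≉0) ⟩
    1# * y ⁻¹              ≈⟨ *-identityˡ _ ⟩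
    y ⁻¹                   ∎

  difference-of-squares : ∀ {u v} → (u - v) * (u + v) ≈ u * u - v * v
  difference-of-squares {u} {v} = solve 2 (λ u v → (u :- v) :* (u :+ v) := u :* u :- v :* v) refl u v

  squares : ∀ {u v} → u * u ≈ v * v → ¬ u ≈ - v → u ≈ v
  squares {u} {v} u²≈v² u≉-v with integral (trans difference-of-squares (residual u²≈v²))
  ... | inj₁ u-v≈0 = fromResidual u-v≈0
  ... | inj₂ u+v≈0 = ⊥-elim (u≉-v (+-inverseˡ-unique u v u+v≈0))

  charZero⇒2≉0 : CharZero → ¬ 1# + 1# ≈ 0#
  charZero⇒2≉0 charZero 2≈0 = charZero 1 (trans (+-congˡ (+-identityʳ 1#)) 2≈0)

  charZero⇒3≉0 : CharZero → ¬ 1# + (1# + 1#) ≈ 0#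
  charZero⇒3≉0 charZero 3≈0 = charZero 2 (trans (+-congˡ (+-congˡ (+-identityʳ 1#))) 3≈0)

module CurveFacts {c ℓ : Level} (F : Field c ℓ) (a b : Field.Carrier F) where
  open Field F
  open Weierstrass F a b
  open FieldFacts F
  open IntegerRingSolver commutativeRing
    using (solve; _:=_; _:*_; _:+_; _:-_; con; residual; fromResidual; _·₀_; _+₀_)
  open AdditionFormulas commutativeRing using (chordLine; doubledFlex)
  open import Algebra.Properties.Ring ring using (-0#≈0#)
  open import Relation.Binary.Reasoning.Setoid setoid

  tangentSlope : Carrier → Carrier → Carrier
  tangentSlope x y = (three * (x * x) + a) * ((two * y) ⁻¹)

  slope-tangent : ∀ {x₁ y₁ x₂ y₂} → x₁ ≈ x₂ → slope (aff x₁ y₁) (aff x₂ y₂) ≡ tangentSlope x₁ y₁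
  slope-tangent {x₁} {_} {x₂} x₁≈x₂ with x₁ ≟ x₂
  ... | yes _     = ≡.refl
  ... | no x₁≉x₂  = ⊥-elim (x₁≉x₂ x₁≈x₂)

  slope-chord : ∀ {x₁ y₁ x₂ y₂} → ¬ x₁ ≈ x₂ → slope (aff x₁ y₁) (aff x₂ y₂) ≡ (y₂ - y₁) * ((x₂ - x₁) ⁻¹)
  slope-chord {x₁} {_} {x₂} x₁≉x₂ with x₁ ≟ x₂
  ... | yes x₁≈x₂ = ⊥-elim (x₁≉x₂ x₁≈x₂)
  ... | no _      = ≡.refl

  ⊕-opposite : ∀ {x₁ y₁ x₂ y₂} → x₁ ≈ x₂ → y₁ ≈ - y₂ → aff x₁ y₁ ⊕ aff x₂ y₂ ≡ 𝒪
  ⊕-opposite {x₁} {y₁} {x₂} {y₂} x₁≈x₂ y₁≈-y₂ with x₁ ≟ x₂ | y₁ ≟ (- y₂)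
  ... | yes _ | yes _      = ≡.refl
  ... | yes _ | no y₁≉-y₂  = ⊥-elim (y₁≉-y₂ y₁≈-y₂)
  ... | no x₁≉x₂ | _       = ⊥-elim (x₁≉x₂ x₁≈x₂)

  -- third intersection of the line of slope l through (x₁, y₁) with abscissa sum x₁ + x₂, reflected
  chordSum : Carrier → Carrier → Carrier → Carrier → Point
  chordSum l x₁ y₁ x₂ = aff (l * l - x₁ - x₂) (l * (x₁ - (l * l - x₁ - x₂)) - y₁)

  ⊕-affine : ∀ {x₁ y₁ x₂ y₂} → ¬ (x₁ ≈ x₂ × y₁ ≈ - y₂) →
    aff x₁ y₁ ⊕ aff x₂ y₂ ≡ chordSum (slope (aff x₁ y₁) (aff x₂ y₂)) x₁ y₁ x₂
  ⊕-affine {x₁} {y₁} {x₂} {y₂} notOpposite with x₁ ≟ x₂ | y₁ ≟ (- y₂)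
  ... | yes x₁≈x₂ | yes y₁≈-y₂ = ⊥-elim (notOpposite (x₁≈x₂ , y₁≈-y₂))
  ... | yes x₁≈x₂ | no _       = ≡.cong (λ l → chordSum l x₁ y₁ x₂) (slope-tangent {x₁} {y₁} {x₂} {y₂} x₁≈x₂)
  ... | no x₁≉x₂  | _          = ≡.cong (λ l → chordSum l x₁ y₁ x₂) (slope-chord {x₁} {y₁} {x₂} {y₂} x₁≉x₂)

  ⊕≅𝒪 : ∀ {x₁ y₁ x₂ y₂} → (aff x₁ y₁ ⊕ aff x₂ y₂) ≅ 𝒪 → x₁ ≈ x₂ × y₁ ≈ - y₂
  ⊕≅𝒪 {x₁} {y₁} {x₂} {y₂} sum≅𝒪 with x₁ ≟ x₂ | y₁ ≟ (- y₂)
  ... | yes x₁≈x₂ | yes y₁≈-y₂ = x₁≈x₂ , y₁≈-y₂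
  ... | yes _     | no _       = ⊥ℓ.⊥-elim sum≅𝒪
  ... | no _      | _          = ⊥ℓ.⊥-elim sum≅𝒪

  chordSlope-spec : ∀ {x₁ y₁ x₂ y₂} → ¬ x₁ ≈ x₂ → slope (aff x₁ y₁) (aff x₂ y₂) * (x₂ - x₁) ≈ y₂ - y₁
  chordSlope-spec {x₁} {y₁} {x₂} {y₂} x₁≉x₂ rewrite slope-chord {x₁} {y₁} {x₂} {y₂} x₁≉x₂ = begin
    (y₂ - y₁) * (x₂ - x₁) ⁻¹ * (x₂ - x₁)   ≈⟨ *-assoc _ _ _ ⟩
    (y₂ - y₁) * ((x₂ - x₁) ⁻¹ * (x₂ - x₁)) ≈⟨ *-congˡ (⁻¹-inverseˡ _ (λ d≈0 → x₁≉x₂ (sym (fromResidual d≈0)))) ⟩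
    (y₂ - y₁) * 1#                          ≈⟨ *-identityʳ _ ⟩
    y₂ - y₁                                 ∎

  record Flex (x y t : Carrier) : Set ℓ where
    field
      y≉0     : ¬ y ≈ 0#
      tangent : t * (two * y) ≈ three * (x * x) + a
      flex    : t * t ≈ three * x

  module OddCharacteristic (two≉0 : ¬ two ≈ 0#) where

    tangentSlope-spec : ∀ {x y} → ¬ y ≈ 0# → tangentSlope x y * (two * y) ≈ three * (x * x) + a
    tangentSlope-spec {x} {y} y≉0 = begin
      (three * (x * x) + a) * (two * y) ⁻¹ * (two * y)   ≈⟨ *-assoc _ _ _ ⟩
      (three * (x * x) + a) * ((two * y) ⁻¹ * (two * y)) ≈⟨ *-congˡ (⁻¹-inverseˡ _ (nonzero-* two≉0 y≉0)) ⟩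
      (three * (x * x) + a) * 1#                          ≈⟨ *-identityʳ _ ⟩
      three * (x * x) + a                                 ∎

    tangentSlope-cong : ∀ {x y x' y'} → x ≈ x' → y ≈ y' → ¬ y ≈ 0# → tangentSlope x y ≈ tangentSlope x' y'
    tangentSlope-cong x≈x' y≈y' y≉0 =
      *-cong (+-congʳ (*-congˡ (*-cong x≈x' x≈x'))) (⁻¹-cong (*-congˡ y≈y') (nonzero-* two≉0 y≉0))

    -- A 3-torsion point T = (x, y) is a flex: T ≠ −T, so y ≠ 0, and 2T = −T forces λ² − 2x = x.
    torsion⇒flex : ∀ {x y} → In3Torsion (aff x y) → Flex x y (tangentSlope x y)
    torsion⇒flex {x} {y} τ = byCase (y ≟ (- y))
      where
      byCase : Dec (y ≈ - y) → Flex x y (tangentSlope x y)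
      byCase (yes y≈-y) = ⊥ℓ.⊥-elim (≡.subst (λ P → (P ⊕ aff x y) ≅ 𝒪) (⊕-opposite refl y≈-y) τ)
      byCase (no y≉-y)  = record
        { y≉0     = y≉0
        ; tangent = tangentSlope-spec y≉0
        ; flex    = fromResidual (trans
            (solve 2 (λ t x → t :* t :- con (+ 3) :* x := t :* t :- x :- x :- x) refl t x)
            (residual doubled≈x))
        }
        where
        y≉0 : ¬ y ≈ 0#
        y≉0 y≈0 = y≉-y (trans y≈0 (trans (sym -0#≈0#) (-‿cong (sym y≈0))))
        t : Carrier
        t = tangentSlope x y
        doubled≈x : t * t - x - x ≈ x
        doubled≈x = ≡.subst (λ l → l * l - x - x ≈ x) (slope-tangent {x} {y} {x} {y} refl)
          (proj₁ (⊕≅𝒪 (≡.subst (λ P → (P ⊕ aff x y) ≅ 𝒪) (⊕-affine (λ (_ , y≈-y) → y≉-y y≈-y)) τ)))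

    collinearFlexes : ∀ {L m x₁ x₂ x₃ y₁ y₂ y₃ t₁ t₂ t₃} → ¬ x₁ ≈ x₂ →
      y₁ ≈ L * x₁ + m → y₂ ≈ L * x₂ + m → y₃ ≈ L * x₃ + m →
      OnCurve (aff x₁ y₁) → OnCurve (aff x₂ y₂) → x₁ + x₂ + x₃ ≈ L * L →
      Flex x₁ y₁ t₁ → Flex x₂ y₂ t₂ → Flex x₃ y₃ t₃ → t₁ + t₂ + t₃ ≈ three * L
    collinearFlexes {L} {m} {x₁} {x₂} {x₃} {y₁} {y₂} {y₃} x₁≉x₂ ℓ₁ ℓ₂ ℓ₃ c₁ c₂ σ f₁ f₂ f₃ =
      fromResidual (cancelˡ δ≉0
        (flexSum ℓ₁ ℓ₂ ℓ₃ (relation roots₁ ℓ₁ f₁) (relation roots₂ ℓ₂ f₂) (relation roots₃ ℓ₃ f₃)))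
      where
      open ChordAlgebra commutativeRing a b L m
        using (Roots; Roots-rotate; chordVieta; tangentExcess; flexExcess; flexOnChord; flexSum)
      open Flex

      x₁-x₂≉0 : ¬ x₁ - x₂ ≈ 0#
      x₁-x₂≉0 d≈0 = x₁≉x₂ (fromResidual d≈0)

      roots₁ : Roots x₁ x₂ x₃
      roots₁ = σ , fromResidual (cancelˡ x₁-x₂≉0 (chordVieta ℓ₁ ℓ₂ c₁ c₂ σ))

      roots₂ : Roots x₂ x₃ x₁
      roots₂ = Roots-rotate roots₁

      roots₃ : Roots x₃ x₁ x₂
      roots₃ = Roots-rotate roots₂

      excess : ∀ {u v w y t} → Roots u v w → y ≈ L * u + m → Flex u y t → two * y * (t - L) ≈ (u - v) * (u - w)
      excess roots ℓ f = tangentExcess roots ℓ (tangent f)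

      relation : ∀ {u v w y t} → Roots u v w → y ≈ L * u + m → Flex u y t →
        (u - v) * (u - w) * (t + L) ≈ two * y * (three * u - L * L)
      relation roots ℓ f = flexExcess (flex f) (excess roots ℓ f)

      -- a flex that is a double root of the chord cubic is a triple root
      doubleRoot : ∀ {u v w y t} → Roots u v w → y ≈ L * u + m → Flex u y t → u - v ≈ 0# → u - w ≈ 0#
      doubleRoot {u} {v} {w} {y} {t} roots ℓ f u-v≈0 = trans
        (solve 3 (λ u v w → u :- w := con -[1+ 0 ] :* ((v :- u) :+ (w :- u)) :+ con -[1+ 0 ] :* (u :- v)) refl u v w)
        (- 1# ·₀ flexOnChord roots t≈L (flex f) +₀ - 1# ·₀ u-v≈0)
        where
        t≈L : t ≈ L
        t≈L = fromResidual (cancelˡ (nonzero-* two≉0 (y≉0 f))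
          (trans (excess roots ℓ f) (trans (*-congʳ u-v≈0) (zeroˡ _))))

      x₂-x₃≉0 : ¬ x₂ - x₃ ≈ 0#
      x₂-x₃≉0 d≈0 = x₁≉x₂ (sym (fromResidual (doubleRoot roots₂ ℓ₂ f₂ d≈0)))

      x₃-x₁≉0 : ¬ x₃ - x₁ ≈ 0#
      x₃-x₁≉0 d≈0 = x₁≉x₂ (trans (sym (fromResidual d≈0)) (fromResidual (doubleRoot roots₃ ℓ₃ f₃ d≈0)))

      δ≉0 : ¬ (x₁ - x₂) * (x₂ - x₃) * (x₃ - x₁) ≈ 0#
      δ≉0 = nonzero-* (nonzero-* x₁-x₂≉0 x₂-x₃≉0) x₃-x₁≉0

    slopeSum : ∀ {x₁ y₁ x₂ y₂ x₃ y₃} → OnCurve (aff x₁ y₁) → OnCurve (aff x₂ y₂) →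
      In3Torsion (aff x₁ y₁) → In3Torsion (aff x₂ y₂) → In3Torsion (aff x₃ y₃) →
      ((aff x₁ y₁ ⊕ aff x₂ y₂) ⊕ aff x₃ y₃) ≅ 𝒪 →
      tangentSlope x₁ y₁ + tangentSlope x₂ y₂ + tangentSlope x₃ y₃ ≈ three * slope (aff x₁ y₁) (aff x₂ y₂)
    slopeSum {x₁} {y₁} {x₂} {y₂} {x₃} {y₃} c₁ c₂ τ₁ τ₂ τ₃ sum≅𝒪 = byAbscissa (x₁ ≟ x₂)
      where
      t₁ t₂ t₃ L : Carrier
      t₁ = tangentSlope x₁ y₁
      t₂ = tangentSlope x₂ y₂
      t₃ = tangentSlope x₃ y₃
      L  = slope (aff x₁ y₁) (aff x₂ y₂)

      f₁ : Flex x₁ y₁ t₁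
      f₁ = torsion⇒flex τ₁
      f₂ : Flex x₂ y₂ t₂
      f₂ = torsion⇒flex τ₂
      f₃ : Flex x₃ y₃ t₃
      f₃ = torsion⇒flex τ₃

      sumIsOpposite : ¬ (x₁ ≈ x₂ × y₁ ≈ - y₂) →
        (L * L - x₁ - x₂ ≈ x₃) × (L * (x₁ - (L * L - x₁ - x₂)) - y₁ ≈ - y₃)
      sumIsOpposite notOpposite = ⊕≅𝒪 (≡.subst (λ P → (P ⊕ aff x₃ y₃) ≅ 𝒪) (⊕-affine notOpposite) sum≅𝒪)

      byAbscissa : Dec (x₁ ≈ x₂) → t₁ + t₂ + t₃ ≈ three * L
      byAbscissa (no x₁≉x₂) =
        let (x≈x₃ , y≈-y₃)     = sumIsOpposite (λ (x₁≈x₂ , _) → x₁≉x₂ x₁≈x₂)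
            (ℓ₁ , ℓ₂ , ℓ₃ , σ) = chordLine (chordSlope-spec x₁≉x₂) x≈x₃ y≈-y₃
        in  collinearFlexes x₁≉x₂ ℓ₁ ℓ₂ ℓ₃ c₁ c₂ σ f₁ f₂ f₃
      -- x₁ = x₂: T₂ = ±T₁, and T₂ = −T₁ would leave T₃ = 𝒪
      byAbscissa (yes x₁≈x₂) = byOrdinate (y₁ ≟ (- y₂))
        where
        byOrdinate : Dec (y₁ ≈ - y₂) → t₁ + t₂ + t₃ ≈ three * L
        byOrdinate (yes y₁≈-y₂) =
          ⊥ℓ.⊥-elim (≡.subst (λ P → (P ⊕ aff x₃ y₃) ≅ 𝒪) (⊕-opposite x₁≈x₂ y₁≈-y₂) sum≅𝒪)
        byOrdinate (no y₁≉-y₂)  = begin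
          t₁ + t₂ + t₃       ≈⟨ +-cong (+-congˡ t₂≈t₁) t₃≈t₁ ⟩
          t₁ + t₁ + t₁       ≈⟨ solve 1 (λ t → t :+ t :+ t := con (+ 3) :* t) refl t₁ ⟩
          three * t₁         ≡⟨ ≡.cong (three *_) L≡t₁ ⟨
          three * L          ∎
          where
          L≡t₁ : L ≡ t₁
          L≡t₁ = slope-tangent {x₁} {y₁} {x₂} {y₂} x₁≈x₂

          y₁≈y₂ : y₁ ≈ y₂
          y₁≈y₂ = squares (trans c₁ (trans cubic-cong (sym c₂))) y₁≉-y₂
            where
            cubic-cong : x₁ * x₁ * x₁ + a * x₁ + b ≈ x₂ * x₂ * x₂ + a * x₂ + b
            cubic-cong = +-congʳ (+-cong (*-cong (*-cong x₁≈x₂ x₁≈x₂) x₁≈x₂) (*-congˡ x₁≈x₂))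

          T₃≈T₁ : x₃ ≈ x₁ × y₃ ≈ y₁
          T₃≈T₁ = let (x≈x₃ , y≈-y₃) = sumIsOpposite (λ (_ , y₁≈-y₂) → y₁≉-y₂ y₁≈-y₂)
                  in  doubledFlex (Flex.flex f₁) x₁≈x₂ (≡.subst (λ l → l * l - x₁ - x₂ ≈ x₃) L≡t₁ x≈x₃)
                        (≡.subst (λ l → l * (x₁ - (l * l - x₁ - x₂)) - y₁ ≈ - y₃) L≡t₁ y≈-y₃)

          t₂≈t₁ : t₂ ≈ t₁
          t₂≈t₁ = tangentSlope-cong (sym x₁≈x₂) (sym y₁≈y₂) (Flex.y≉0 f₂)

          t₃≈t₁ : t₃ ≈ t₁
          t₃≈t₁ = tangentSlope-cong (proj₁ T₃≈T₁) (proj₂ T₃≈T₁) (Flex.y≉0 f₃)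

open Weierstrass using (𝒪; aff)

lemma4p2 : ∀ {c ℓ : Level} (F : Field c ℓ) → FieldTheory.IsAlgClosureOfℚ F →
    (a b : Field.Carrier F) → Weierstrass.Nonsingular F a b →
    (T₁ T₂ T₃ : Weierstrass.Point F a b) →
    Weierstrass.OnCurve F a b T₁ → Weierstrass.OnCurve F a b T₂ → Weierstrass.OnCurve F a b T₃ →
    ¬ Weierstrass._≅_ F a b T₁ (Weierstrass.𝒪 {F = F} {a} {b}) →
    ¬ Weierstrass._≅_ F a b T₂ (Weierstrass.𝒪 {F = F} {a} {b}) →
    ¬ Weierstrass._≅_ F a b T₃ (Weierstrass.𝒪 {F = F} {a} {b}) →
    Weierstrass.In3Torsion F a b T₁ → Weierstrass.In3Torsion F a b T₂ → Weierstrass.In3Torsion F a b T₃ →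
    Weierstrass._≅_ F a b (Weierstrass._⊕_ F a b (Weierstrass._⊕_ F a b T₁ T₂) T₃) (Weierstrass.𝒪 {F = F} {a} {b}) →
    Field._≈_ F (Weierstrass.slope F a b T₁ T₂)
      (Field._*_ F (Field._⁻¹ F (Weierstrass.three F a b))
        (Field._+_ F (Field._+_ F (Weierstrass.slope F a b T₁ T₁) (Weierstrass.slope F a b T₂ T₂))
          (Weierstrass.slope F a b T₃ T₃)))
lemma4p2 F _ a b _ 𝒪 _ _ _ _ _ T₁≉𝒪 _ _ _ _ _ _ = ⊥-elim (T₁≉𝒪 tt)
lemma4p2 F _ a b _ (aff _ _) 𝒪 _ _ _ _ _ T₂≉𝒪 _ _ _ _ _ = ⊥-elim (T₂≉𝒪 tt)
lemma4p2 F _ a b _ (aff _ _) (aff _ _) 𝒪 _ _ _ _ _ T₃≉𝒪 _ _ _ _ = ⊥-elim (T₃≉𝒪 tt)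
lemma4p2 F (charZero , _) a b _ (aff x₁ y₁) (aff x₂ y₂) (aff x₃ y₃) c₁ c₂ _ _ _ _ τ₁ τ₂ τ₃ sum≅𝒪
  rewrite CurveFacts.slope-tangent F a b {x₁} {y₁} {x₁} {y₁} (Field.refl F)
        | CurveFacts.slope-tangent F a b {x₂} {y₂} {x₂} {y₂} (Field.refl F)
        | CurveFacts.slope-tangent F a b {x₃} {y₃} {x₃} {y₃} (Field.refl F)
  = solveLinear (charZero⇒3≉0 charZero) (Field.sym F (slopeSum c₁ c₂ τ₁ τ₂ τ₃ sum≅𝒪))
  where
  open FieldFacts F using (solveLinear; charZero⇒2≉0; charZero⇒3≉0)
  open CurveFacts.OddCharacteristic F a b (charZero⇒2≉0 charZero) using (slopeSum)
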